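{- (1) Let $(L,{}')$ be a complete ortholattice and define ${}^\perp:{\cal DI}(L)\to{\cal DI}(L)$ by $A^\perp={\downarrow}\bigl((\bigvee_L A)'\bigr)$. Then $({\cal DI}(L),{}^\perp)$ (ordered by inclusion) is a complete ${\cal DJD}$-pseudo-ortho Heyting algebra, $A^{\perp\perp}={\downarrow}\bigl(\bigvee_L A\bigr)$ for all $A\in{\cal DI}(L)$, and the range of ${}^\perp$ equipped with the restriction of ${}^\perp$ is isomorphic (as a complete ortholattice) to $(L,{}')$. (2) Let $(H,{}')$ be a complete ${\cal DJD}$-pseudo-ortho Heyting algebra and let $H'=\{a'\mid a\in H\}$. Then $H'$ with the induced order and the restriction of ${}'$ is a complete ortholattice, and $({\cal DI}(H'),{}^\perp)$ constructed from it as in (1) is isomorphic to $(H,{}')$. Consequently $(L,{}')\mapsto({\cal DI}(L),{}^\perp)$ and $(H,{}')\mapsto(H',{}'|_{H'})$ induce mutually inverse bijections between isomorphism classes of complete ortholattices and isomorphism classes of complete ${\cal DJD}$-pseudo-ortho Heyting algebras.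
   Context: Consider the following conditions on a map ${}':P\to P$ on a bounded lattice $P$: OC1: $a\wedge a'=0$; OC2: $a\le a''$; OC3$_l$: $b'\le a'\Rightarrow a\le b$; OC3$_r$: $a\le b\Rightarrow b'\le a'$. A complete ortholattice is a complete lattice with a map ${}'$ satisfying OC1, OC2, OC3$_l$. For a complete lattice $M$ and $B\subseteq M$, $\bigvee_M B$ is distributive if $c\wedge\bigvee_M B=\bigvee_M\{c\wedge b\mid b\in B\}$ for all $c\in M$; a distributive ideal of $M$ is a nonempty downward closed subset closed under distributive joins of its subsets; ${\cal DI}(M)$ is the set of these (it is a complete Heyting algebra under inclusion). ${\downarrow}x=\{y\mid y\le x\}$. For a complete lattice $H$, a subset $M\subseteq H$ closed under arbitrary meets of $H$ (including the empty meet) is called ${\cal DJD}$ in $H$ if $a=\bigvee_H\{b\in M\mid b\le a\}$ for all $a\in H$ and $\{b\in M\mid b\le a\}\in{\cal DI}(M)$ for all $a\in H$ (with $M$ carrying the induced order). A complete ${\cal DJD}$-pseudo-ortho Heyting algebra is a complete Heyting algebra $H$ (complete lattice in which binary meets distribute over arbitrary joins) with a map ${}':H\to H$ satisfying OC1, OC2, OC3$_r$ whose range $H'$ is ${\cal DJD}$ in $H$. Isomorphisms in both classes are order-isomorphisms commuting with the respective maps ${}'$. -}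

module Defs where

open import Level using (Level; _⊔_; suc; Lift; lift; lower)
open import Data.Product using (Σ; ∃; _×_; _,_; proj₁; proj₂; Σ-syntax; ∃-syntax)
open import Data.Sum using (_⊎_)
open import Relation.Nullary using (¬_)

-- A (complete) lattice is represented by a preorder whose
-- quotient by  x ≈ y  (x ≤ y and y ≤ x)  is the poset of the paper.

record Preord (c ℓ : Level) : Set (suc (c ⊔ ℓ)) where
  field
    Carrier : Set c
    _≤_     : Carrier → Carrier → Set ℓ
    ≤-refl  : ∀ {x} → x ≤ x
    ≤-trans : ∀ {x y z} → x ≤ y → y ≤ z → x ≤ z

module PreordDefs {c ℓ : Level} (P : Preord c ℓ) where
  open Preord P

  Pred : Set (suc (c ⊔ ℓ))
  Pred = Carrier → Set (c ⊔ ℓ)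

  _≈_ : Carrier → Carrier → Set ℓ
  x ≈ y = x ≤ y × y ≤ x

  IsUB : Pred → Carrier → Set (c ⊔ ℓ)
  IsUB S x = ∀ y → S y → y ≤ x

  IsLB : Pred → Carrier → Set (c ⊔ ℓ)
  IsLB S x = ∀ y → S y → x ≤ y

  IsLub : Pred → Carrier → Set (c ⊔ ℓ)
  IsLub S x = IsUB S x × (∀ u → IsUB S u → x ≤ u)

  IsGlb : Pred → Carrier → Set (c ⊔ ℓ)
  IsGlb S x = IsLB S x × (∀ u → IsLB S u → u ≤ x)

  IsMeet : Carrier → Carrier → Carrier → Set (c ⊔ ℓ)
  IsMeet a b m = m ≤ a × m ≤ b × (∀ x → x ≤ a → x ≤ b → x ≤ m)

  IsBot : Carrier → Set (c ⊔ ℓ)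
  IsBot m = ∀ x → m ≤ x

  IsComplete : Set (suc (c ⊔ ℓ))
  IsComplete = (S : Pred) → Σ Carrier (IsLub S)

  DistJoin : Pred → Carrier → Set (c ⊔ ℓ)
  DistJoin B j = ∀ a m → IsMeet a j m → IsLub (λ x → ∃[ b ] (B b × IsMeet a b x)) m

  record IsDistIdeal (I : Pred) : Set (suc (c ⊔ ℓ)) where
    field
      nonempty : ∃[ x ] I x
      down     : ∀ {x y} → y ≤ x → I x → I y
      closed   : ∀ (B : Pred) j → (∀ x → B x → I x) → IsLub B j → DistJoin B j → I j

  IsHeyting : Set (suc (c ⊔ ℓ))
  IsHeyting = ∀ (S : Pred) j → IsLub S j → DistJoin S j

  Sub : Pred → Preord (c ⊔ ℓ) ℓ
  Sub M = record
    { Carrier = Σ Carrier M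
    ; _≤_     = λ x y → proj₁ x ≤ proj₁ y
    ; ≤-refl  = ≤-refl
    ; ≤-trans = ≤-trans
    }

module _ {c ℓ : Level} (P : Preord c ℓ) where
  open Preord P
  open PreordDefs P

  record IsDJD (M : Pred) : Set (suc (c ⊔ ℓ)) where
    field
      meetClosed : ∀ (S : Pred) m → (∀ x → S x → M x) → IsGlb S m → M m
      dense      : ∀ a → IsLub (λ b → M b × b ≤ a) a
      ideal      : ∀ a → PreordDefs.IsDistIdeal (Sub M) (λ b → Lift c (proj₁ b ≤ a))

-- Structures: a preorder with a map ′ respecting ≈ (well-definedness of
-- ′ on the quotient poset).

record Str (c ℓ : Level) : Set (suc (c ⊔ ℓ)) where
  field
    pre : Preord c ℓ
  open Preord pre public
  open PreordDefs pre public
  field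
    _′    : Carrier → Carrier
    ′-cong : ∀ {x y} → x ≈ y → (x ′) ≈ (y ′)

module StrDefs {c ℓ : Level} (S : Str c ℓ) where
  open Str S

  OC1 : Set (c ⊔ ℓ)
  OC1 = ∀ a m → IsMeet a (a ′) m → IsBot m

  OC2 : Set (c ⊔ ℓ)
  OC2 = ∀ a → a ≤ ((a ′) ′)

  OC3l : Set (c ⊔ ℓ)
  OC3l = ∀ a b → (b ′) ≤ (a ′) → a ≤ b

  OC3r : Set (c ⊔ ℓ)
  OC3r = ∀ a b → a ≤ b → (b ′) ≤ (a ′)

  Rng : Pred
  Rng a = ∃[ b ] (a ≈ (b ′))

open StrDefs public

record IsCompleteOrtholattice {c ℓ} (S : Str c ℓ) : Set (suc (c ⊔ ℓ)) where
  open Str S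
  field
    complete : IsComplete
    oc1      : OC1 S
    oc2      : OC2 S
    oc3l     : OC3l S

record IsCompleteDJDPseudoOrthoHeyting {c ℓ} (S : Str c ℓ) : Set (suc (c ⊔ ℓ)) where
  open Str S
  field
    complete : IsComplete
    heyting  : IsHeyting
    oc1      : OC1 S
    oc2      : OC2 S
    oc3r     : OC3r S
    djd      : IsDJD pre (Rng S)

record Iso {c₁ ℓ₁ c₂ ℓ₂} (S : Str c₁ ℓ₁) (T : Str c₂ ℓ₂) : Set (c₁ ⊔ ℓ₁ ⊔ c₂ ⊔ ℓ₂) where
  private
    module S = Str S
    module T = Str T
  field
    to      : S.Carrier → T.Carrier
    from    : T.Carrier → S.Carrier
    to-mono : ∀ {x y} → x S.≤ y → to x T.≤ to y
    to-refl : ∀ {x y} → to x T.≤ to y → x S.≤ y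
    from-to : ∀ x → from (to x) S.≈ x
    to-from : ∀ y → to (from y) T.≈ y
    to-′    : ∀ x → to (x S.′) T.≈ (to x T.′)

RangeStr : ∀ {c ℓ} → Str c ℓ → Str (c ⊔ ℓ) ℓ
RangeStr {c} {ℓ} S = record
  { pre    = Sub (Rng S)
  ; _′     = λ x → (proj₁ x ′) , proj₁ x , ≤-refl , ≤-refl
  ; ′-cong = ′-cong
  }
  where open Str S

module DIConstruction {c ℓ} (L : Str c ℓ) (comp : PreordDefs.IsComplete (Str.pre L)) where
  open Str L

  DI : Set (suc (c ⊔ ℓ))
  DI = Σ Pred IsDistIdeal

  ⋁ : Pred → Carrier
  ⋁ A = proj₁ (comp A)

  ↓ : Carrier → DI
  ↓ x = (λ y → Lift c (y ≤ x)) , record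
    { nonempty = x , lift ≤-refl
    ; down     = λ y≤x' p → lift (≤-trans y≤x' (lower p))
    ; closed   = λ B j B⊆ lub → λ _ → lift (proj₂ lub x (λ y By → lower (B⊆ y By)))
    }

  DIPre : Preord (suc (c ⊔ ℓ)) (c ⊔ ℓ)
  DIPre = record
    { Carrier = DI
    ; _≤_     = λ A B → ∀ x → proj₁ A x → proj₁ B x
    ; ≤-refl  = λ x p → p
    ; ≤-trans = λ f g x p → g x (f x p)
    }

  _⊥ : DI → DI
  A ⊥ = ↓ (⋁ (proj₁ A) ′)

  private
    ⋁-mono : ∀ (A B : Pred) → (∀ x → A x → B x) → ⋁ A ≤ ⋁ B
    ⋁-mono A B f = proj₂ (proj₂ (comp A)) (⋁ B) (λ y Ay → proj₁ (proj₂ (comp B)) y (f y Ay))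

    ↓-mono : ∀ {x y} → x ≤ y → ∀ z → proj₁ (↓ x) z → proj₁ (↓ y) z
    ↓-mono x≤y z p = lift (≤-trans (lower p) x≤y)

  ⊥-cong : ∀ {A B : DI} → PreordDefs._≈_ DIPre A B → PreordDefs._≈_ DIPre (A ⊥) (B ⊥)
  ⊥-cong {A} {B} (f , g) =
    let e = ′-cong (⋁-mono (proj₁ A) (proj₁ B) f , ⋁-mono (proj₁ B) (proj₁ A) g)
    in ↓-mono (proj₁ e) , ↓-mono (proj₂ e)

  DIStr : Str (suc (c ⊔ ℓ)) (c ⊔ ℓ)
  DIStr = record { pre = DIPre ; _′ = _⊥ ; ′-cong = λ {A} {B} → ⊥-cong {A} {B} }

DIStr : ∀ {c ℓ} (L : Str c ℓ) → PreordDefs.IsComplete (Str.pre L) → Str (suc (c ⊔ ℓ)) (c ⊔ ℓ)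
DIStr L comp = DIConstruction.DIStr L comp

-- Classical ambient mathematics (hypotheses of the theorem):
-- propositional resizing (power sets are impredicative in ZFC) and
-- excluded middle.

Resizing : (a : Level) → Set (suc (suc a))
Resizing a = (P : Set (suc a)) → Σ (Set a) (λ Q → (Q → P) × (P → Q))

ExcludedMiddle : (a : Level) → Set (suc a)
ExcludedMiddle a = (P : Set a) → P ⊎ ¬ P

module Submission where

-- For a distributive ideal A of a complete ortholattice L, A^⊥⊥ = ↓(⋁ A); so the range
-- of ⊥ consists of the principal ideals and ⋁ identifies it with L. DI(L) is a complete
-- Heyting algebra: the join of a family is the intersection of all ideals above it, and
-- A ⇒ U = { y | ↓ y ∩ A ⊆ U } is again a distributive ideal. Conversely, in a DJD
-- pseudo-ortho Heyting algebra H the range H′ is closed under meets, has joins (⋁ S)′′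
-- and is a complete ortholattice, and a ↦ { b ∈ H′ | b ≤ a } is an isomorphism H ≅ DI(H′)
-- with inverse I ↦ ⋁ I: density gives one composite, and every b ∈ H′ below ⋁ I lies in I,
-- being the distributive join of its meets with the elements of I.

open import Defs
open import Level using (Level; _⊔_; suc; Lift; lift; lower)
open import Data.Product using (Σ; _×_; proj₁; proj₂; _,_; ∃-syntax)
open import Data.Sum using (_⊎_; inj₁; inj₂)
open import Data.Empty using () renaming (⊥ to Empty)

module PreordProps {c ℓ} (P : Preord c ℓ) where
  open Preord P
  open PreordDefs P

  ≈-refl : ∀ {x} → x ≈ x
  ≈-refl = ≤-refl , ≤-refl

  ≈-sym : ∀ {x y} → x ≈ y → y ≈ x
  ≈-sym (p , q) = q , p

  ≈-trans : ∀ {x y z} → x ≈ y → y ≈ z → x ≈ z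
  ≈-trans (p , q) (p′ , q′) = ≤-trans p p′ , ≤-trans q′ q

  lub-unique : ∀ {S x y} → IsLub S x → IsLub S y → x ≈ y
  lub-unique (ubx , leastx) (uby , leasty) = leastx _ uby , leasty _ ubx

  lub-resp-≈ : ∀ {S x y} → x ≈ y → IsLub S x → IsLub S y
  lub-resp-≈ (p , q) (ub , least) =
    (λ z Sz → ≤-trans (ub z Sz) p) , λ u ubu → ≤-trans q (least u ubu)

  sameUB⇒sameLub : ∀ {S T x} → (∀ u → IsUB S u → IsUB T u) → (∀ u → IsUB T u → IsUB S u)
                 → IsLub S x → IsLub T x
  sameUB⇒sameLub S⇒T T⇒S (ub , least) = S⇒T _ ub , λ u ubu → least u (T⇒S u ubu)

  meet-resp-≈ : ∀ {a b m a′ b′ m′} → a ≈ a′ → b ≈ b′ → m ≈ m′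
              → IsMeet a b m → IsMeet a′ b′ m′
  meet-resp-≈ (a≤ , ≥a) (b≤ , ≥b) (m≤ , ≥m) (ma , mb , glb) =
    ≤-trans ≥m (≤-trans ma a≤) , ≤-trans ≥m (≤-trans mb b≤) ,
    λ x xa xb → ≤-trans (glb x (≤-trans xa ≥a) (≤-trans xb ≥b)) m≤

  ≤⇒meet : ∀ {a b} → a ≤ b → IsMeet a b a
  ≤⇒meet ab = ≤-refl , ab , λ x xa _ → xa

  module Joins (complete : IsComplete) where
    sup : Pred → Carrier
    sup S = proj₁ (complete S)

    sup-ub : ∀ S x → S x → x ≤ sup S
    sup-ub S = proj₁ (proj₂ (complete S))

    sup-least : ∀ S u → IsUB S u → sup S ≤ u
    sup-least S = proj₂ (proj₂ (complete S))

    meet : Carrier → Carrier → Carrier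
    meet a b = sup (λ x → Lift c (x ≤ a × x ≤ b))

    meet-isMeet : ∀ a b → IsMeet a b (meet a b)
    meet-isMeet a b = sup-least _ a (λ _ p → proj₁ (lower p)) ,
                      sup-least _ b (λ _ p → proj₂ (lower p)) ,
                      λ x xa xb → sup-ub _ x (lift (xa , xb))

    bot : Carrier
    bot = sup (λ _ → Lift (c ⊔ ℓ) Empty)

    bot-isBot : IsBot bot
    bot-isBot x = sup-least _ x (λ _ ())

    -- With m = c ∧ z ≤ j, distributivity of j gives m = ⋁ { m ∧ b }, and m ∧ b = c ∧ (z ∧ b).
    distJoin-restrict : ∀ {B j z} → z ≤ j → DistJoin B j
                      → DistJoin (λ x → ∃[ b ] (B b × IsMeet z b x)) z
    distJoin-restrict {B} {j} {z} z≤j distB c′ m (mc , mz , glb) =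
      sameUB⇒sameLub direct⇒nested nested⇒direct (distB m m (≤⇒meet (≤-trans mz z≤j)))
      where
        Direct Nested : Pred
        Direct w = ∃[ b ] (B b × IsMeet m b w)
        Nested w = ∃[ x ] ((∃[ b ] (B b × IsMeet z b x)) × IsMeet c′ x w)

        direct⇒nested : ∀ u → IsUB Direct u → IsUB Nested u
        direct⇒nested u ub w (x , (b , Bb , (xz , xb , _)) , (wc , wx , _)) =
          ≤-trans (proj₂ (proj₂ (meet-isMeet m b)) w (glb w wc (≤-trans wx xz)) (≤-trans wx xb))
                  (ub (meet m b) (b , Bb , meet-isMeet m b))

        nested⇒direct : ∀ u → IsUB Nested u → IsUB Direct u
        nested⇒direct u ub w (b , Bb , (wm , wb , glbw)) =
          ub w (meet z b , (b , Bb , meet-isMeet z b) ,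
                (≤-trans wm mc ,
                 proj₂ (proj₂ (meet-isMeet z b)) w (≤-trans wm mz) wb ,
                 λ y yc yzb → glbw y (glb y yc (≤-trans yzb (proj₁ (meet-isMeet z b))))
                                     (≤-trans yzb (proj₁ (proj₂ (meet-isMeet z b))))))

record OrderEquiv {c₁ ℓ₁ c₂ ℓ₂} (P : Preord c₁ ℓ₁) (Q : Preord c₂ ℓ₂)
                  : Set (c₁ ⊔ ℓ₁ ⊔ c₂ ⊔ ℓ₂) where
  private
    module P = Preord P
    module Q = Preord Q
  field
    to        : P.Carrier → Q.Carrier
    from      : Q.Carrier → P.Carrier
    to-mono   : ∀ {x y} → x P.≤ y → to x Q.≤ to y
    from-mono : ∀ {x y} → x Q.≤ y → from x P.≤ from y
    from-to   : ∀ x → PreordDefs._≈_ P (from (to x)) x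
    to-from   : ∀ y → PreordDefs._≈_ Q (to (from y)) y

OrderEquiv-sym : ∀ {c₁ ℓ₁ c₂ ℓ₂} {P : Preord c₁ ℓ₁} {Q : Preord c₂ ℓ₂}
               → OrderEquiv P Q → OrderEquiv Q P
OrderEquiv-sym e = record
  { to = from ; from = to ; to-mono = from-mono ; from-mono = to-mono ; from-to = to-from ; to-from = from-to }
  where open OrderEquiv e

module OrderEquivLemmas {c₁ ℓ₁ c₂ ℓ₂} {P : Preord c₁ ℓ₁} {Q : Preord c₂ ℓ₂}
                        (e : OrderEquiv P Q) where
  open OrderEquiv e
  private
    module P = Preord P
    module Q = Preord Q
    module PD = PreordDefs P
    module QD = PreordDefs Q

  to-reflects : ∀ {x y} → to x Q.≤ to y → x P.≤ y
  to-reflects {x} {y} p = P.≤-trans (proj₂ (from-to x)) (P.≤-trans (from-mono p) (proj₁ (from-to y)))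

  to-cong : ∀ {x y} → x PD.≈ y → to x QD.≈ to y
  to-cong (p , q) = to-mono p , to-mono q

  Corresponds : PD.Pred → QD.Pred → Set (c₁ ⊔ ℓ₁ ⊔ c₂ ⊔ ℓ₂)
  Corresponds S T = (∀ s → S s → ∃[ t ] (T t × to s QD.≈ t))
                  × (∀ t → T t → ∃[ s ] (S s × t QD.≈ to s))

  to-meet : ∀ {a b m} → PD.IsMeet a b m → QD.IsMeet (to a) (to b) (to m)
  to-meet {a} {b} (ma , mb , glb) = to-mono ma , to-mono mb ,
    λ x xa xb → Q.≤-trans (proj₂ (to-from x)) (to-mono (glb (from x)
       (P.≤-trans (from-mono xa) (proj₁ (from-to a))) (P.≤-trans (from-mono xb) (proj₁ (from-to b)))))

  to-lub : ∀ {S T x} → Corresponds S T → PD.IsLub S x → QD.IsLub T (to x)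
  to-lub (S→T , T→S) (ub , least) =
    (λ t Tt → let (s , Ss , t≈) = T→S t Tt in Q.≤-trans (proj₁ t≈) (to-mono (ub s Ss))) ,
    λ u ubu → Q.≤-trans (to-mono (least (from u) (λ s Ss →
         let (t , Tt , ≈t) = S→T s Ss in
         P.≤-trans (proj₂ (from-to s)) (from-mono (Q.≤-trans (proj₁ ≈t) (ubu t Tt))))))
       (proj₁ (to-from u))

module OrderEquivTransport {c₁ ℓ₁ c₂ ℓ₂} {P : Preord c₁ ℓ₁} {Q : Preord c₂ ℓ₂}
                           (e : OrderEquiv P Q) where
  open OrderEquiv e
  open OrderEquivLemmas e public
  private
    module PD = PreordDefs P
    module QD = PreordDefs Q
    module PP = PreordProps P
    module QP = PreordProps Q
    module Inv = OrderEquivLemmas (OrderEquiv-sym e)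

  Corresponds-sym : ∀ {S T} → Corresponds S T → Inv.Corresponds T S
  Corresponds-sym (S→T , T→S) =
    (λ t Tt → let (s , Ss , t≈) = T→S t Tt in s , Ss , PP.≈-trans (Inv.to-cong t≈) (from-to s)) ,
    (λ s Ss → let (t , Tt , ≈t) = S→T s Ss in t , Tt , PP.≈-trans (PP.≈-sym (from-to s)) (Inv.to-cong ≈t))

  to-distJoin : ∀ {B T j} → Corresponds B T → PD.DistJoin B j → QD.DistJoin T (to j)
  to-distJoin {B} {T} {j} (B→T , T→B) distB a m am =
    QP.lub-resp-≈ (to-from m)
      (to-lub (meets→ , meets←)
        (distB (from a) (from m) (PP.meet-resp-≈ PP.≈-refl (from-to j) PP.≈-refl (Inv.to-meet am))))
    where
      meets→ : ∀ x → (∃[ b ] (B b × PD.IsMeet (from a) b x))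
             → ∃[ y ] ((∃[ t ] (T t × QD.IsMeet a t y)) × to x QD.≈ y)
      meets→ x (b , Bb , mx) = let (t , Tt , ≈t) = B→T b Bb in
        to x , (t , Tt , QP.meet-resp-≈ (to-from a) ≈t QP.≈-refl (to-meet mx)) , QP.≈-refl
      meets← : ∀ y → (∃[ t ] (T t × QD.IsMeet a t y))
             → ∃[ x ] ((∃[ b ] (B b × PD.IsMeet (from a) b x)) × y QD.≈ to x)
      meets← y (t , Tt , my) = let (b , Bb , t≈) = T→B t Tt in
        from y , (b , Bb , PP.meet-resp-≈ PP.≈-refl (PP.≈-trans (Inv.to-cong t≈) (from-to b)) PP.≈-refl
                             (Inv.to-meet my)) ,
        QP.≈-sym (to-from y)

preimage-isDistIdeal : ∀ {c ℓ} {P Q : Preord c ℓ} (e : OrderEquiv P Q) {J : PreordDefs.Pred P}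
                     → PreordDefs.IsDistIdeal P J
                     → PreordDefs.IsDistIdeal Q (λ y → J (OrderEquiv.from e y))
preimage-isDistIdeal {P = P} {Q} e {J} isJ = record
  { nonempty = let (x , Jx) = nonempty in to x , down (proj₁ (from-to x)) Jx
  ; down     = λ y≤x Jx → down (from-mono y≤x) Jx
  ; closed   = λ B j B⊆ lub distB →
      closed (Image B) (from j) (λ { x (y , By , x≈) → down (proj₁ x≈) (B⊆ y By) })
        (Inv.to-lub (image-corresponds B) lub) (Inv.to-distJoin (image-corresponds B) distB)
  }
  where
    open OrderEquiv e
    open PreordDefs.IsDistIdeal isJ
    module Inv = OrderEquivTransport (OrderEquiv-sym e)

    Image : PreordDefs.Pred Q → PreordDefs.Pred P
    Image B x = ∃[ y ] (B y × PreordDefs._≈_ P x (from y))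

    image-corresponds : ∀ B → Inv.Corresponds B (Image B)
    image-corresponds B =
      (λ y By → from y , (y , By , PreordProps.≈-refl P) , PreordProps.≈-refl P) , (λ x Ix → Ix)

Iso⇒OrderEquiv : ∀ {c₁ ℓ₁ c₂ ℓ₂} {S : Str c₁ ℓ₁} {T : Str c₂ ℓ₂}
               → Iso S T → OrderEquiv (Str.pre S) (Str.pre T)
Iso⇒OrderEquiv {T = T} i = record
  { to = to ; from = from ; to-mono = to-mono
  ; from-mono = λ {x} {y} p → to-refl (T.≤-trans (proj₁ (to-from x)) (T.≤-trans p (proj₂ (to-from y))))
  ; from-to = from-to ; to-from = to-from }
  where
    open Iso i
    module T = Str T

OrderEquiv⇒Iso : ∀ {c₁ ℓ₁ c₂ ℓ₂} {S : Str c₁ ℓ₁} {T : Str c₂ ℓ₂}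
                 (e : OrderEquiv (Str.pre S) (Str.pre T))
               → (∀ x → Str._≈_ T (OrderEquiv.to e (Str._′ S x)) (Str._′ T (OrderEquiv.to e x)))
               → Iso S T
OrderEquiv⇒Iso e to-′ = record
  { to = to ; from = from ; to-mono = to-mono ; to-refl = to-reflects
  ; from-to = from-to ; to-from = to-from ; to-′ = to-′ }
  where
    open OrderEquiv e
    open OrderEquivLemmas e using (to-reflects)

Iso-sym : ∀ {c₁ ℓ₁ c₂ ℓ₂} {S : Str c₁ ℓ₁} {T : Str c₂ ℓ₂} → Iso S T → Iso T S
Iso-sym {S = S} {T = T} i = OrderEquiv⇒Iso (OrderEquiv-sym e) from-′
  where
    module S = Str S
    module T = Str T
    module SP = PreordProps S.pre

    e : OrderEquiv S.pre T.pre
    e = Iso⇒OrderEquiv i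

    open OrderEquiv e
    open OrderEquivLemmas (OrderEquiv-sym e) using () renaming (to-cong to from-cong)

    from-′ : ∀ y → from (y T.′) S.≈ (from y S.′)
    from-′ y = SP.≈-trans (from-cong (T.′-cong (PreordProps.≈-sym T.pre (to-from y))))
                (SP.≈-trans (from-cong (PreordProps.≈-sym T.pre (Iso.to-′ i (from y)))) (from-to _))

-- Subsets of S and T live at different levels, so images of subsets of S must be supplied.
IsCompleteOrtholattice-pullback :
  ∀ {c₁ ℓ₁ c₂ ℓ₂} {S : Str c₁ ℓ₁} {T : Str c₂ ℓ₂} (i : Iso S T)
  → ((P : Str.Pred S) → Σ (Str.Pred T) (OrderEquivLemmas.Corresponds (Iso⇒OrderEquiv i) P))
  → IsCompleteOrtholattice T → IsCompleteOrtholattice S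
IsCompleteOrtholattice-pullback {S = S} {T = T} i image colT = record
  { complete = λ P → let (Q , cor) = image P in
      from (proj₁ (T.complete Q)) , Inv.to-lub (E.Corresponds-sym cor) (proj₂ (T.complete Q))
  ; oc1  = λ a m ma x → E.to-reflects (T.oc1 (to a) (to m)
             (TP.meet-resp-≈ TP.≈-refl (to-′ a) TP.≈-refl (E.to-meet ma)) (to x))
  ; oc2  = λ a → E.to-reflects (T.≤-trans (T.oc2 (to a))
             (proj₂ (TP.≈-trans (to-′ (a S.′)) (T.′-cong (to-′ a)))))
  ; oc3l = λ a b p → E.to-reflects (T.oc3l (to a) (to b)
             (T.≤-trans (proj₂ (to-′ b)) (T.≤-trans (to-mono p) (proj₁ (to-′ a)))))
  }
  where
    open Iso i using (to-′)

    e : OrderEquiv (Str.pre S) (Str.pre T)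
    e = Iso⇒OrderEquiv i

    open OrderEquiv e
    module E = OrderEquivTransport e
    module Inv = OrderEquivLemmas (OrderEquiv-sym e)
    module S = Str S
    module T where
      open Str T public
      open IsCompleteOrtholattice colT public
    module TP = PreordProps T.pre

module OrtholatticeProps {c ℓ} (L : Str c ℓ) (col : IsCompleteOrtholattice L) where
  open Str L
  open IsCompleteOrtholattice col

  ′′≈ : ∀ x → ((x ′) ′) ≈ x
  ′′≈ x = oc3l ((x ′) ′) x (oc2 (x ′)) , oc2 x

  ′-antitone : OC3r L
  ′-antitone a b a≤b = oc3l (b ′) (a ′) (≤-trans (proj₁ (′′≈ a)) (≤-trans a≤b (proj₂ (′′≈ b))))

module DistIdeals {c ℓ} (L : Str c ℓ) (col : IsCompleteOrtholattice L) (resize : Resizing (c ⊔ ℓ)) where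
  open Str L
  open IsCompleteOrtholattice col
  open PreordProps pre
  open Joins complete
  open OrtholatticeProps L col
  open DIConstruction L complete hiding (DIStr)

  DS : Str (suc (c ⊔ ℓ)) (c ⊔ ℓ)
  DS = DIStr L complete

  module D = Str DS
  module DP = PreordProps DIPre

  ⟨_⟩ : DI → Pred
  ⟨ A ⟩ = proj₁ A

  module _ (A : DI) where
    open IsDistIdeal (proj₂ A) public

  ⋁-ub : ∀ A x → A x → x ≤ ⋁ A
  ⋁-ub = sup-ub

  ⋁-mono : ∀ (A B : Pred) → (∀ x → A x → B x) → ⋁ A ≤ ⋁ B
  ⋁-mono A B A⊆B = sup-least A (⋁ B) (λ y Ay → ⋁-ub B y (A⊆B y Ay))

  ⋁-cong : ∀ {A B : DI} → A D.≈ B → ⋁ ⟨ A ⟩ ≈ ⋁ ⟨ B ⟩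
  ⋁-cong (A⊆B , B⊆A) = ⋁-mono _ _ A⊆B , ⋁-mono _ _ B⊆A

  ⋁↓ : ∀ x → ⋁ ⟨ ↓ x ⟩ ≈ x
  ⋁↓ x = sup-least _ x (λ _ p → lower p) , ⋁-ub _ x (lift ≤-refl)

  ↓-mono : ∀ {x y} → x ≤ y → ↓ x D.≤ ↓ y
  ↓-mono x≤y z z≤x = lift (≤-trans (lower z≤x) x≤y)

  ↓-cong : ∀ {x y} → x ≈ y → ↓ x D.≈ ↓ y
  ↓-cong (p , q) = ↓-mono p , ↓-mono q

  bot∈ : ∀ (A : DI) → ⟨ A ⟩ bot
  bot∈ A = let (x , Ax) = nonempty A in down A (bot-isBot x) Ax

  ↓-∈Rng : ∀ x → Rng DS (↓ x)
  ↓-∈Rng x = ↓ (x ′) , ↓-cong (≈-trans (≈-sym (′′≈ x)) (≈-sym (′-cong (⋁↓ (x ′)))))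

  Rng⇒principal : ∀ {A} → Rng DS A → A D.≈ ↓ (⋁ ⟨ A ⟩)
  Rng⇒principal {A} (B , A≈B⊥) =
    DP.≈-trans {A} {B ⊥} {↓ (⋁ ⟨ A ⟩)} A≈B⊥
      (↓-cong (≈-sym (≈-trans (⋁-cong {A} {B ⊥} A≈B⊥) (⋁↓ _))))

  _∩_ : DI → DI → DI
  A ∩ B = (λ x → ⟨ A ⟩ x × ⟨ B ⟩ x) , record
    { nonempty = bot , bot∈ A , bot∈ B
    ; down     = λ y≤x p → down A y≤x (proj₁ p) , down B y≤x (proj₂ p)
    ; closed   = λ C j C⊆ lub distC → closed A C j (λ x p → proj₁ (C⊆ x p)) lub distC ,
                                      closed B C j (λ x p → proj₂ (C⊆ x p)) lub distC
    }

  ∩-isMeet : ∀ A B → D.IsMeet A B (A ∩ B)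
  ∩-isMeet A B = (λ _ p → proj₁ p) , (λ _ p → proj₂ p) , λ X X⊆A X⊆B x p → X⊆A x p , X⊆B x p

  -- Resizing brings the intersection of all ideals above S down to the level of subsets of L.
  module _ (S : D.Pred) where
    private
      InEveryUB : Carrier → Set (suc (c ⊔ ℓ))
      InEveryUB x = (I : DI) → (∀ A → S A → A D.≤ I) → ⟨ I ⟩ x

      Generated : Pred
      Generated x = proj₁ (resize (InEveryUB x))

      intro : ∀ {x} → InEveryUB x → Generated x
      intro = proj₂ (proj₂ (resize _))

      elim : ∀ {x} → Generated x → InEveryUB x
      elim = proj₁ (proj₂ (resize _))

    generated : DI
    generated = Generated , record
      { nonempty = bot , intro (λ I _ → bot∈ I)
      ; down     = λ y≤x gx → intro (λ I S≤I → down I y≤x (elim gx I S≤I))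
      ; closed   = λ B j B⊆ lub distB →
          intro (λ I S≤I → closed I B j (λ x Bx → elim (B⊆ x Bx) I S≤I) lub distB)
      }

    generated-isLub : D.IsLub S generated
    generated-isLub = (λ A SA y Ay → intro (λ I S≤I → S≤I A SA y Ay)) , λ U ub x gx → elim gx U ub

  DI-complete : D.IsComplete
  DI-complete S = generated S , generated-isLub S

  -- Closed under a distributive join j since each z ≤ j is the distributive join of the z ∧ b.
  _⇒_ : DI → DI → DI
  A ⇒ U = (λ y → ∀ z → z ≤ y → ⟨ A ⟩ z → ⟨ U ⟩ z) , record
    { nonempty = bot , λ z z≤bot _ → down U z≤bot (bot∈ U)
    ; down     = λ y′≤y h z z≤y′ Az → h z (≤-trans z≤y′ y′≤y) Az
    ; closed   = λ B j B⊆ lub distB z z≤j Az →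
        closed U (λ x → ∃[ b ] (B b × IsMeet z b x)) z
          (λ x (b , Bb , (xz , xb , _)) → B⊆ b Bb x xb (down A xz Az))
          (distB z z (≤⇒meet z≤j)) (distJoin-restrict z≤j distB)
    }

  DI-heyting : D.IsHeyting
  DI-heyting S J (ub , least) A M (M⊆A , M⊆J , glb) =
    (λ X (B , SB , (X⊆A , X⊆B , _)) → glb X X⊆A (λ x p → ub B SB x (X⊆B x p))) ,
    λ U ubU x Mx → J⊆A⇒U U ubU x (M⊆J x Mx) x ≤-refl (M⊆A x Mx)
    where
      J⊆A⇒U : ∀ U → D.IsUB (λ X → ∃[ B ] (S B × D.IsMeet A B X)) U → J D.≤ (A ⇒ U)
      J⊆A⇒U U ubU = least (A ⇒ U) (λ B SB y By z z≤y Az →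
                      ubU (A ∩ B) (B , SB , ∩-isMeet A B) z (Az , down B z≤y By))

  DI-oc1 : OC1 DS
  DI-oc1 A M (M⊆A , M⊆A⊥ , _) X x Mx =
    let (y , Xy) = nonempty X
        x≤a∧a′ = proj₂ (proj₂ (meet-isMeet _ _)) x (⋁-ub _ x (M⊆A x Mx)) (lower (M⊆A⊥ x Mx))
    in down X (≤-trans x≤a∧a′ (oc1 (⋁ ⟨ A ⟩) _ (meet-isMeet _ _) y)) Xy

  DI-oc2 : OC2 DS
  DI-oc2 A x Ax = lift (≤-trans (⋁-ub _ x Ax) (≤-trans (oc2 _) (proj₂ (′-cong (⋁↓ _)))))

  DI-oc3r : OC3r DS
  DI-oc3r A B A⊆B x p = lift (≤-trans (lower p) (′-antitone _ _ (⋁-mono _ _ A⊆B)))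

  ⊥⊥≈↓⋁ : ∀ A → ((A ⊥) ⊥) D.≈ ↓ (⋁ ⟨ A ⟩)
  ⊥⊥≈↓⋁ A = ↓-cong (≈-trans (′-cong (⋁↓ _)) (′′≈ _))

  RangeD : Preord (suc (c ⊔ ℓ)) (c ⊔ ℓ)
  RangeD = Str.pre (RangeStr DS)

  principal≃L : OrderEquiv RangeD pre
  principal≃L = record
    { to        = λ A → ⋁ ⟨ proj₁ A ⟩
    ; from      = λ x → ↓ x , ↓-∈Rng x
    ; to-mono   = λ A⊆B → ⋁-mono _ _ A⊆B
    ; from-mono = ↓-mono
    ; from-to   = λ A → DP.≈-sym {proj₁ A} {↓ (⋁ ⟨ proj₁ A ⟩)} (Rng⇒principal {proj₁ A} (proj₂ A))
    ; to-from   = ⋁↓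
    }

  module PT = OrderEquivTransport principal≃L

  joinsOf : (P : PreordDefs.Pred RangeD) → Σ Pred (PT.Corresponds P)
  joinsOf P = (λ y → proj₁ (resize (∃[ A ] (P A × y ≈ ⋁ ⟨ proj₁ A ⟩)))) ,
              (λ A PA → ⋁ ⟨ proj₁ A ⟩ , proj₂ (proj₂ (resize _)) (A , PA , ≈-refl) , ≈-refl) ,
              (λ y Jy → proj₁ (proj₂ (resize _)) Jy)

  Rng-meetClosed : ∀ (S : D.Pred) M → (∀ A → S A → Rng DS A) → D.IsGlb S M → Rng DS M
  Rng-meetClosed S M S⊆Rng (lb , glb) =
    ↓ (⋁ ⟨ M ⟩ ′) , DP.≈-trans {M} {↓ (⋁ ⟨ M ⟩)} {↓ (⋁ ⟨ M ⟩ ′) ⊥} M≈↓⋁M (proj₂ (↓-∈Rng _))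
    where
      ↓⋁M⊆M : ↓ (⋁ ⟨ M ⟩) D.≤ M
      ↓⋁M⊆M = glb (↓ (⋁ ⟨ M ⟩)) (λ A SA y y≤ →
                proj₂ (Rng⇒principal {A} (S⊆Rng A SA)) y
                  (lift (≤-trans (lower y≤) (⋁-mono _ _ (lb A SA)))))
      M≈↓⋁M : M D.≈ ↓ (⋁ ⟨ M ⟩)
      M≈↓⋁M = (λ x Mx → lift (⋁-ub _ x Mx)) , ↓⋁M⊆M

  Rng-dense : ∀ A → D.IsLub (λ B → Rng DS B × B D.≤ A) A
  Rng-dense A = (λ _ p → proj₂ p) ,
    λ U ubU x Ax → ubU (↓ x) (↓-∈Rng x , λ y y≤x → down A (lower y≤x) Ax) x (lift ≤-refl)

  Rng-below-isDistIdeal : ∀ A → PreordDefs.IsDistIdeal RangeD (λ B → Lift (suc (c ⊔ ℓ)) (proj₁ B D.≤ A))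
  Rng-below-isDistIdeal A = record
    { nonempty = (↓ bot , ↓-∈Rng bot) , lift (λ y y≤bot → down A (lower y≤bot) (bot∈ A))
    ; down     = λ C≤B B⊆A → lift (λ z Cz → lower B⊆A z (C≤B z Cz))
    ; closed   = λ B j B⊆A lub distB →
        let (J , cor) = joinsOf B
            ⋁j∈A = closed A J (⋁ ⟨ proj₁ j ⟩) (J⊆A B J B⊆A cor)
                     (PT.to-lub {B} {J} {j} cor lub) (PT.to-distJoin {B} {J} {j} cor distB)
        in lift (λ x xj → down A (⋁-ub _ x xj) ⋁j∈A)
    }
    where
      J⊆A : ∀ B J → (∀ C → B C → Lift (suc (c ⊔ ℓ)) (proj₁ C D.≤ A))
          → PT.Corresponds B J → ∀ y → J y → ⟨ A ⟩ y
      J⊆A B J B⊆A (_ , J→B) y Jy =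
        let (C , BC , y≈) = J→B y Jy in
        down A (proj₁ y≈) (lower (B⊆A C BC) _ (proj₂ (Rng⇒principal {proj₁ C} (proj₂ C)) _ (lift ≤-refl)))

  DI-isPseudoOrthoHeyting : IsCompleteDJDPseudoOrthoHeyting DS
  DI-isPseudoOrthoHeyting = record
    { complete = DI-complete ; heyting = DI-heyting
    ; oc1 = DI-oc1 ; oc2 = DI-oc2 ; oc3r = DI-oc3r
    ; djd = record { meetClosed = Rng-meetClosed ; dense = Rng-dense ; ideal = Rng-below-isDistIdeal }
    }

  Range≅L : Iso (RangeStr DS) L
  Range≅L = OrderEquiv⇒Iso principal≃L (λ _ → ⋁↓ _)

  Range-isOrtholattice : IsCompleteOrtholattice (RangeStr DS)
  Range-isOrtholattice = IsCompleteOrtholattice-pullback Range≅L joinsOf col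

module PseudoOrthoRange {c ℓ} (H : Str c ℓ) (isH : IsCompleteDJDPseudoOrthoHeyting H) where
  open Str H
  open IsCompleteDJDPseudoOrthoHeyting isH
  open PreordProps pre
  open Joins complete
  open IsDJD djd

  M : Pred
  M = Rng H

  ′′′≈′ : ∀ a → (((a ′) ′) ′) ≈ (a ′)
  ′′′≈′ a = oc3r _ _ (oc2 a) , oc2 (a ′)

  Rng-′′≈ : ∀ {x} → M x → ((x ′) ′) ≈ x
  Rng-′′≈ (b , x≈b′) = ≈-trans (′-cong (′-cong x≈b′)) (≈-trans (′′′≈′ b) (≈-sym x≈b′))

  Rng-resp-≈ : ∀ {x y} → x ≈ y → M x → M y
  Rng-resp-≈ x≈y (b , x≈b′) = b , ≈-trans (≈-sym x≈y) x≈b′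

  Rng-meet : ∀ {a b m} → M a → M b → IsMeet a b m → M m
  Rng-meet {a} {b} Ma Mb (ma , mb , glb) =
    meetClosed (λ z → Lift c (z ≈ a ⊎ z ≈ b)) _
      (λ { _ (lift (inj₁ z≈a)) → Rng-resp-≈ (≈-sym z≈a) Ma
         ; _ (lift (inj₂ z≈b)) → Rng-resp-≈ (≈-sym z≈b) Mb })
      ((λ { _ (lift (inj₁ z≈a)) → ≤-trans ma (proj₂ z≈a)
          ; _ (lift (inj₂ z≈b)) → ≤-trans mb (proj₂ z≈b) }) ,
       λ u lb → glb u (lb a (lift (inj₁ ≈-refl))) (lb b (lift (inj₂ ≈-refl))))

  RS : Str (c ⊔ ℓ) ℓ
  RS = RangeStr H

  module RS = Str RS

  RS-meet⇒meet : ∀ {a b m : RS.Carrier} → RS.IsMeet a b m → IsMeet (proj₁ a) (proj₁ b) (proj₁ m)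
  RS-meet⇒meet {a} {b} (ma , mb , glb) =
    let a∧b = meet-isMeet (proj₁ a) (proj₁ b)
        a∧b≤m = glb (_ , Rng-meet (proj₂ a) (proj₂ b) a∧b) (proj₁ a∧b) (proj₁ (proj₂ a∧b))
    in meet-resp-≈ ≈-refl ≈-refl (a∧b≤m , proj₂ (proj₂ a∧b) _ ma mb) a∧b

  meet⇒RS-meet : ∀ {a b m : RS.Carrier} → IsMeet (proj₁ a) (proj₁ b) (proj₁ m) → RS.IsMeet a b m
  meet⇒RS-meet (ma , mb , glb) = ma , mb , λ x xa xb → glb (proj₁ x) xa xb

  elementsOf : RS.Pred → Pred
  elementsOf S x = Σ (M x) (λ Mx → S (x , Mx))

  RS-complete : RS.IsComplete
  RS-complete S =
    (((j ′) ′) , j ′ , ≈-refl) ,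
    (λ { (x , Mx) Sx → ≤-trans (sup-ub _ x (Mx , Sx)) (oc2 j) }) ,
    λ u ub → ≤-trans (oc3r _ _ (oc3r _ _ (sup-least _ (proj₁ u) (λ x p → ub (x , proj₁ p) (proj₂ p)))))
                     (proj₁ (Rng-′′≈ (proj₂ u)))
    where
      j : Carrier
      j = sup (elementsOf S)

  RS-isOrtholattice : IsCompleteOrtholattice RS
  RS-isOrtholattice = record
    { complete = RS-complete
    ; oc1  = λ a m m≈a∧a′ x →
        let a∧a′ = meet-isMeet (proj₁ a) (proj₁ a ′) in
        ≤-trans (proj₂ (proj₂ a∧a′) _ (proj₁ m≈a∧a′) (proj₁ (proj₂ m≈a∧a′)))
                (oc1 (proj₁ a) _ a∧a′ (proj₁ x))
    ; oc2  = λ a → oc2 (proj₁ a)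
    ; oc3l = λ a b b′≤a′ → ≤-trans (proj₂ (Rng-′′≈ (proj₂ a)))
                             (≤-trans (oc3r _ _ b′≤a′) (proj₁ (Rng-′′≈ (proj₂ b))))
    }

  sup-≈-by-density : ∀ (Q : Pred) a → (∀ x → Q x → x ≤ a) → (∀ x → M x → x ≤ a → Q x) → sup Q ≈ a
  sup-≈-by-density Q a Q≤a Q⊇M↓a =
    sup-least _ a Q≤a , proj₂ (dense a) (sup Q) (λ b (Mb , b≤a) → sup-ub _ b (Q⊇M↓a b Mb b≤a))

  open DIConstruction RS RS-complete using (DI)

  DR : Str (suc (c ⊔ ℓ)) (c ⊔ ℓ)
  DR = DIStr RS RS-complete

  module DR = Str DR

  toH : DI → Carrier
  toH A = sup (elementsOf (proj₁ A))

  fromH : Carrier → DI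
  fromH a = (λ b → Lift c (proj₁ b ≤ a)) , ideal a

  -- b = ⋁ { b ∧ t | t ∈ A } is a distributive join in H by the Heyting law, hence in H′.
  below-toH-∈ : ∀ (A : DI) (b : RS.Carrier) → proj₁ b ≤ toH A → proj₁ A b
  below-toH-∈ (A , isA) (b , Mb) b≤j = closed T (b , Mb) T⊆A T-lub T-distJoin
    where
      open PreordDefs.IsDistIdeal isA

      X : Pred
      X x = ∃[ t ] (elementsOf A t × IsMeet b t x)

      X-lub : IsLub X b
      X-lub = heyting (elementsOf A) _ (proj₂ (complete _)) b b (≤⇒meet b≤j)

      X-distJoin : DistJoin X b
      X-distJoin = heyting X b X-lub

      X⊆M : ∀ x → X x → M x
      X⊆M x (t , (Mt , _) , x=b∧t) = Rng-meet Mb Mt x=b∧t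

      T : RS.Pred
      T y = X (proj₁ y)

      T⊆A : ∀ y → T y → A y
      T⊆A (x , Mx) (t , (Mt , At) , (_ , x≤t , _)) = down {t , Mt} {x , Mx} x≤t At

      T-lub : RS.IsLub T (b , Mb)
      T-lub = (λ { _ (_ , _ , (x≤b , _ , _)) → x≤b }) ,
              λ u ubu → proj₂ X-lub (proj₁ u) (λ x Xx → ubu (x , X⊆M x Xx) Xx)

      T-distJoin : RS.DistJoin T (b , Mb)
      T-distJoin a m m=a∧b =
        (λ { x (y , Ty , (x≤a , x≤y , _)) →
               proj₂ (proj₂ m=a∧b) x x≤a (≤-trans x≤y (proj₁ (proj₂ (proj₂ Ty)))) }) ,
        λ u ubu → proj₂ (X-distJoin (proj₁ a) (proj₁ m) (RS-meet⇒meet {a} {b , Mb} {m} m=a∧b))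
          (proj₁ u) (λ x′ (x , Xx , x′=a∧x) →
            let Mx′ = Rng-meet (proj₂ a) (X⊆M x Xx) x′=a∧x in
            ubu (x′ , Mx′) ((x , X⊆M x Xx) , Xx , meet⇒RS-meet {a} {x , X⊆M x Xx} {x′ , Mx′} x′=a∧x))

  from-toH : ∀ A → fromH (toH A) DR.≈ A
  from-toH A = (λ b b≤j → below-toH-∈ A b (lower b≤j)) ,
               λ y Ay → lift (sup-ub _ (proj₁ y) (proj₂ y , Ay))

  toH-fromH : ∀ a → toH (fromH a) ≈ a
  toH-fromH a = sup-≈-by-density _ a (λ _ p → lower (proj₂ p)) (λ _ Mx x≤a → Mx , lift x≤a)

  DR≅H : Iso DR H
  DR≅H = record
    { to      = toH
    ; from    = fromH
    ; to-mono = λ A⊆B → sup-least _ _ (λ x p → sup-ub _ x (proj₁ p , A⊆B (x , proj₁ p) (proj₂ p)))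
    ; to-refl = λ {A} {B} p y Ay → proj₁ (from-toH B) y (lift (≤-trans (sup-ub _ _ (proj₂ y , Ay)) p))
    ; from-to = from-toH
    ; to-from = toH-fromH
    -- A ⊥ is ↓ (toH A)′′′ with its predicate lifted to another level than in fromH.
    ; to-′    = λ A → ≈-trans
        (sup-≈-by-density _ _ (λ _ p → lower (proj₂ p)) (λ _ Mx x≤a → Mx , lift x≤a)) (′′′≈′ (toH A))
    }

module _ {c ℓ} {L₁ L₂ : Str c ℓ} (comp₁ : PreordDefs.IsComplete (Str.pre L₁))
         (comp₂ : PreordDefs.IsComplete (Str.pre L₂)) where
  private
    module L₁ = Str L₁
    module L₂ = Str L₂
    module D₁ = DIConstruction L₁ comp₁
    module D₂ = DIConstruction L₂ comp₂

  preimageDI : Iso L₁ L₂ → D₁.DI → D₂.DI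
  preimageDI i A = (λ y → proj₁ A (Iso.from i y)) , preimage-isDistIdeal (Iso⇒OrderEquiv i) (proj₂ A)

  preimageDI-⊥ : ∀ (i : Iso L₁ L₂) A
               → Str._≈_ (DIStr L₂ comp₂) (preimageDI i (A D₁.⊥)) (preimageDI i A D₂.⊥)
  preimageDI-⊥ i A =
    (λ y y≤ → lift (L₂.≤-trans (proj₂ (to-from y))
                      (L₂.≤-trans (to-mono (lower y≤)) (proj₁ to-⋁′≈)))) ,
    (λ y y≤ → lift (L₁.≤-trans (from-mono (L₂.≤-trans (lower y≤) (proj₂ to-⋁′≈)))
                      (proj₁ (from-to _))))
    where
      e : OrderEquiv L₁.pre L₂.pre
      e = Iso⇒OrderEquiv i

      open OrderEquiv e
      module P₂ = PreordProps L₂.pre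

      A↑ : L₂.Pred
      A↑ y = proj₁ A (from y)

      ⋁A↑≈to⋁A : D₂.⋁ A↑ L₂.≈ to (D₁.⋁ (proj₁ A))
      ⋁A↑≈to⋁A = P₂.lub-unique (proj₂ (comp₂ A↑))
        (OrderEquivLemmas.to-lub e {proj₁ A} {A↑}
          ((λ x Ax → to x , IsDistIdeal.down (proj₂ A) (proj₁ (from-to x)) Ax , P₂.≈-refl) ,
           (λ y A↑y → from y , A↑y , P₂.≈-sym (to-from y)))
          (proj₂ (comp₁ (proj₁ A))))
        where open PreordDefs L₁.pre using (module IsDistIdeal)

      to-⋁′≈ : to (D₁.⋁ (proj₁ A) L₁.′) L₂.≈ (D₂.⋁ A↑ L₂.′)
      to-⋁′≈ = P₂.≈-trans (Iso.to-′ i _) (P₂.≈-sym (L₂.′-cong ⋁A↑≈to⋁A))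

DIStr-resp-Iso : ∀ {c ℓ} {L₁ L₂ : Str c ℓ} (comp₁ : PreordDefs.IsComplete (Str.pre L₁))
                 (comp₂ : PreordDefs.IsComplete (Str.pre L₂))
               → Iso L₁ L₂ → Iso (DIStr L₁ comp₁) (DIStr L₂ comp₂)
DIStr-resp-Iso {L₁ = L₁} {L₂} comp₁ comp₂ i = record
  { to      = preimageDI comp₁ comp₂ i
  ; from    = preimageDI comp₂ comp₁ (Iso-sym i)
  ; to-mono = λ A⊆B y → A⊆B (from y)
  ; to-refl = λ {A} {B} A↑⊆B↑ x Ax →
      down₁ B (proj₂ (from-to x)) (A↑⊆B↑ (to x) (down₁ A (proj₁ (from-to x)) Ax))
  ; from-to = λ A → (λ x → down₁ A (proj₂ (from-to x))) , (λ x → down₁ A (proj₁ (from-to x)))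
  ; to-from = λ B → (λ y → down₂ B (proj₂ (to-from y))) , (λ y → down₂ B (proj₁ (to-from y)))
  ; to-′    = preimageDI-⊥ comp₁ comp₂ i
  }
  where
    open Iso i

    down₁ : ∀ (A : DIConstruction.DI L₁ comp₁) {x y} → Str._≤_ L₁ y x → proj₁ A x → proj₁ A y
    down₁ A = PreordDefs.IsDistIdeal.down (proj₂ A)

    down₂ : ∀ (A : DIConstruction.DI L₂ comp₂) {x y} → Str._≤_ L₂ y x → proj₁ A x → proj₁ A y
    down₂ A = PreordDefs.IsDistIdeal.down (proj₂ A)

rangeMap : ∀ {c₁ ℓ₁ c₂ ℓ₂} {S : Str c₁ ℓ₁} {T : Str c₂ ℓ₂} → Iso S T
         → Str.Carrier (RangeStr S) → Str.Carrier (RangeStr T)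
rangeMap {T = T} i (x , b , x≈b′) =
  to x , to b ,
  PreordProps.≈-trans (Str.pre T) (OrderEquivLemmas.to-cong (Iso⇒OrderEquiv i) x≈b′) (to-′ b)
  where open Iso i

RangeStr-resp-Iso : ∀ {c₁ ℓ₁ c₂ ℓ₂} {H₁ : Str c₁ ℓ₁} {H₂ : Str c₂ ℓ₂}
                  → Iso H₁ H₂ → Iso (RangeStr H₁) (RangeStr H₂)
RangeStr-resp-Iso i = record
  { to      = rangeMap i
  ; from    = rangeMap (Iso-sym i)
  ; to-mono = to-mono
  ; to-refl = to-refl
  ; from-to = λ x → from-to (proj₁ x)
  ; to-from = λ y → to-from (proj₁ y)
  ; to-′    = λ x → to-′ (proj₁ x)
  }
  where open Iso i

theorem7 : ∀ {c ℓ : Level}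
  → Resizing (c ⊔ ℓ)
  → ExcludedMiddle (c ⊔ ℓ)
  -- (1)
  → (∀ (L : Str c ℓ) (col : IsCompleteOrtholattice L)
       → IsCompleteDJDPseudoOrthoHeyting (DIStr L (IsCompleteOrtholattice.complete col))
       × (∀ (A : DIConstruction.DI L (IsCompleteOrtholattice.complete col))
            → Str._≈_ (DIStr L (IsCompleteOrtholattice.complete col))
                (DIConstruction._⊥ L (IsCompleteOrtholattice.complete col)
                  (DIConstruction._⊥ L (IsCompleteOrtholattice.complete col) A))
                (DIConstruction.↓ L (IsCompleteOrtholattice.complete col)
                  (DIConstruction.⋁ L (IsCompleteOrtholattice.complete col) (proj₁ A))))
       × IsCompleteOrtholattice (RangeStr (DIStr L (IsCompleteOrtholattice.complete col)))
       × Iso (RangeStr (DIStr L (IsCompleteOrtholattice.complete col))) L)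
  -- (2)
  × (∀ (H : Str c ℓ) → IsCompleteDJDPseudoOrthoHeyting H
       → Σ (IsCompleteOrtholattice (RangeStr H))
           (λ col → Iso (DIStr (RangeStr H) (IsCompleteOrtholattice.complete col)) H))
  -- the two assignments are well defined on isomorphism classes
  × (∀ (L₁ L₂ : Str c ℓ) (col₁ : IsCompleteOrtholattice L₁) (col₂ : IsCompleteOrtholattice L₂)
       → Iso L₁ L₂
       → Iso (DIStr L₁ (IsCompleteOrtholattice.complete col₁))
             (DIStr L₂ (IsCompleteOrtholattice.complete col₂)))
  × (∀ (H₁ H₂ : Str c ℓ)
       → IsCompleteDJDPseudoOrthoHeyting H₁ → IsCompleteDJDPseudoOrthoHeyting H₂
       → Iso H₁ H₂ → Iso (RangeStr H₁) (RangeStr H₂))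
theorem7 resize _ =
  (λ L col → let open DistIdeals L col resize in
     DI-isPseudoOrthoHeyting , ⊥⊥≈↓⋁ , Range-isOrtholattice , Range≅L) ,
  (λ H isH → let open PseudoOrthoRange H isH in RS-isOrtholattice , DR≅H) ,
  (λ _ _ col₁ col₂ → DIStr-resp-Iso (IsCompleteOrtholattice.complete col₁)
                                     (IsCompleteOrtholattice.complete col₂)) ,
  (λ H₁ H₂ _ _ → RangeStr-resp-Iso)
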